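{- If $G$ is a $\{P_4+P_1,C_4\}$-free graph, then $\mathsf{tree}\text{ - }\alpha(G)\le 3$.
   Context: All graphs are finite, simple and undirected. A graph is $\mathcal{F}$-free if it has no induced subgraph isomorphic to a member of $\mathcal{F}$. A tree decomposition of $G$ is a pair $(T,\{X_t\}_{t\in V(T)})$ with $T$ a tree and bags $X_t\subseteq V(G)$ such that every vertex lies in some bag, every edge has both endpoints in some bag, and for each vertex $v$ the nodes whose bags contain $v$ induce a connected subtree. $\mathsf{tree}\text{ - }\alpha(G)$ is the minimum over tree decompositions of $\max_t\alpha(G[X_t])$. -}

module Defs where

open import Data.Nat using (ℕ; zero; suc; _≤_)
open import Data.Fin using (Fin; zero; suc; inject₁; fromℕ)
open import Data.Bool using (Bool; true; false)
open import Data.Product using (Σ; ∃; _×_; _,_)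
open import Data.Empty using (⊥)
open import Relation.Nullary using (¬_)
open import Relation.Binary.PropositionalEquality using (_≡_)
open import Function.Definitions using (Injective)

record Graph : Set where
  field
    n     : ℕ
    adj   : Fin n → Fin n → Bool
    sym   : ∀ u v → adj u v ≡ adj v u
    irrefl : ∀ v → adj v v ≡ false
open Graph public

Vtx : Graph → Set
Vtx G = Fin (n G)

InducedSub : Graph → Graph → Set
InducedSub H G =
  Σ (Vtx H → Vtx G) λ f →
    Injective _≡_ _≡_ f × (∀ u v → adj G (f u) (f v) ≡ adj H u v)

Free : (Graph → Set) → Graph → Set
Free 𝓕 G = ∀ H → 𝓕 H → ¬ InducedSub H G

p4p1-adj : Fin 5 → Fin 5 → Bool
p4p1-adj zero (suc zero) = true
p4p1-adj (suc zero) zero = true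
p4p1-adj (suc zero) (suc (suc zero)) = true
p4p1-adj (suc (suc zero)) (suc zero) = true
p4p1-adj (suc (suc zero)) (suc (suc (suc zero))) = true
p4p1-adj (suc (suc (suc zero))) (suc (suc zero)) = true
p4p1-adj _ _ = false

P4+P1 : Graph
P4+P1 = record
  { n = 5 ; adj = p4p1-adj
  ; sym = λ { zero zero → _≡_.refl ; zero (suc zero) → _≡_.refl ; zero (suc (suc zero)) → _≡_.refl
            ; zero (suc (suc (suc zero))) → _≡_.refl ; zero (suc (suc (suc (suc zero)))) → _≡_.refl
            ; (suc zero) zero → _≡_.refl ; (suc zero) (suc zero) → _≡_.refl ; (suc zero) (suc (suc zero)) → _≡_.refl
            ; (suc zero) (suc (suc (suc zero))) → _≡_.refl ; (suc zero) (suc (suc (suc (suc zero)))) → _≡_.refl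
            ; (suc (suc zero)) zero → _≡_.refl ; (suc (suc zero)) (suc zero) → _≡_.refl ; (suc (suc zero)) (suc (suc zero)) → _≡_.refl
            ; (suc (suc zero)) (suc (suc (suc zero))) → _≡_.refl ; (suc (suc zero)) (suc (suc (suc (suc zero)))) → _≡_.refl
            ; (suc (suc (suc zero))) zero → _≡_.refl ; (suc (suc (suc zero))) (suc zero) → _≡_.refl ; (suc (suc (suc zero))) (suc (suc zero)) → _≡_.refl
            ; (suc (suc (suc zero))) (suc (suc (suc zero))) → _≡_.refl ; (suc (suc (suc zero))) (suc (suc (suc (suc zero)))) → _≡_.refl
            ; (suc (suc (suc (suc zero)))) zero → _≡_.refl ; (suc (suc (suc (suc zero)))) (suc zero) → _≡_.refl ; (suc (suc (suc (suc zero)))) (suc (suc zero)) → _≡_.refl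
            ; (suc (suc (suc (suc zero)))) (suc (suc (suc zero))) → _≡_.refl ; (suc (suc (suc (suc zero)))) (suc (suc (suc (suc zero)))) → _≡_.refl }
  ; irrefl = λ { zero → _≡_.refl ; (suc zero) → _≡_.refl ; (suc (suc zero)) → _≡_.refl
               ; (suc (suc (suc zero))) → _≡_.refl ; (suc (suc (suc (suc zero)))) → _≡_.refl } }

c4-adj : Fin 4 → Fin 4 → Bool
c4-adj zero (suc zero) = true
c4-adj (suc zero) zero = true
c4-adj (suc zero) (suc (suc zero)) = true
c4-adj (suc (suc zero)) (suc zero) = true
c4-adj (suc (suc zero)) (suc (suc (suc zero))) = true
c4-adj (suc (suc (suc zero))) (suc (suc zero)) = true
c4-adj (suc (suc (suc zero))) zero = true
c4-adj zero (suc (suc (suc zero))) = true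
c4-adj _ _ = false

C4 : Graph
C4 = record
  { n = 4 ; adj = c4-adj
  ; sym = λ { zero zero → _≡_.refl ; zero (suc zero) → _≡_.refl ; zero (suc (suc zero)) → _≡_.refl
            ; zero (suc (suc (suc zero))) → _≡_.refl
            ; (suc zero) zero → _≡_.refl ; (suc zero) (suc zero) → _≡_.refl ; (suc zero) (suc (suc zero)) → _≡_.refl
            ; (suc zero) (suc (suc (suc zero))) → _≡_.refl
            ; (suc (suc zero)) zero → _≡_.refl ; (suc (suc zero)) (suc zero) → _≡_.refl ; (suc (suc zero)) (suc (suc zero)) → _≡_.refl
            ; (suc (suc zero)) (suc (suc (suc zero))) → _≡_.refl
            ; (suc (suc (suc zero))) zero → _≡_.refl ; (suc (suc (suc zero))) (suc zero) → _≡_.refl ; (suc (suc (suc zero))) (suc (suc zero)) → _≡_.refl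
            ; (suc (suc (suc zero))) (suc (suc (suc zero))) → _≡_.refl }
  ; irrefl = λ { zero → _≡_.refl ; (suc zero) → _≡_.refl ; (suc (suc zero)) → _≡_.refl
               ; (suc (suc (suc zero))) → _≡_.refl } }

data Forbidden : Graph → Set where
  isP4+P1 : Forbidden P4+P1
  isC4    : Forbidden C4

VSet : Graph → Set
VSet G = Vtx G → Bool

data Reach (G : Graph) (S : VSet G) : Vtx G → Vtx G → Set where
  here : ∀ {u} → S u ≡ true → Reach G S u u
  step : ∀ {u w v} → S u ≡ true → adj G u w ≡ true → Reach G S w v → Reach G S u v

ConnectedSet : (G : Graph) → VSet G → Set
ConnectedSet G S = ∀ u v → S u ≡ true → S v ≡ true → Reach G S u v

Connected : Graph → Set
Connected G = ConnectedSet G (λ _ → true)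

HasCycle : Graph → Set
HasCycle G =
  Σ ℕ λ k → Σ (Fin (suc (suc (suc k))) → Vtx G) λ c →
    Injective _≡_ _≡_ c
    × (∀ (i : Fin (suc (suc k))) → adj G (c (inject₁ i)) (c (suc i)) ≡ true)
    × adj G (c (fromℕ (suc (suc k)))) (c zero) ≡ true

record IsTree (T : Graph) : Set where
  field
    nonempty : Vtx T
    connected : Connected T
    acyclic : ¬ HasCycle T

record TreeDecomposition (G : Graph) : Set₁ where
  field
    T      : Graph
    isTree : IsTree T
    bag    : Vtx T → VSet G
    cover  : ∀ v → Σ (Vtx T) λ t → bag t v ≡ true
    edge   : ∀ u v → adj G u v ≡ true →
               Σ (Vtx T) λ t → (bag t u ≡ true) × (bag t v ≡ true)
    interp : ∀ v → ConnectedSet T (λ t → bag t v)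

IndepAtMost : (G : Graph) → VSet G → ℕ → Set
IndepAtMost G X k =
  ∀ s (f : Fin s → Vtx G) → Injective _≡_ _≡_ f →
    (∀ i → X (f i) ≡ true) → (∀ i j → adj G (f i) (f j) ≡ false) → s ≤ k

TreeAlphaAtMost : Graph → ℕ → Set₁
TreeAlphaAtMost G k =
  Σ (TreeDecomposition G) λ D → ∀ t → IndepAtMost G (TreeDecomposition.bag D t) k

-- Let v be a vertex of minimum closed degree and M the set of vertices outside N[v],
-- ordered by rank = (number of neighbours in M, index).  Forbidding P4+P1 and C4
-- forces the closed M-neighbourhoods to grow along edges of increasing rank, so the
-- up-neighbours of a vertex a of M form a clique, and attaching each a to its
-- lowest-ranked up-neighbour (or to a root carrying N[v]) gives a tree.  The bag of a
-- holds a, its up-neighbours, and the vertices of N(v) adjacent to a or to a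
-- down-neighbour of a.  By minimality of the degree of v, N(v) contains no independent
-- triple, so every bag, being a clique together with a subset of N(v), has α ≤ 3.
module Submission where

open import Defs hiding (sym)
open import Data.Nat using (ℕ; zero; suc; _+_; _*_; _≤_; _<_; z≤n; s≤s; _≤?_; _<?_)
open import Data.Nat.Properties using (≤-refl; ≤-trans; ≤-reflexive; ≤-antisym; <⇒≤; ≰⇒>; <⇒≱; ≤∧≢⇒<; <-irrefl; <-asym; <-trans; <-≤-trans; <-cmp; m≤n⇒m≤1+n; m≤m+n; +-comm; +-monoʳ-<; +-cancelˡ-≡; *-monoˡ-≤; module ≤-Reasoning)
open import Data.Fin using (Fin; zero; suc; toℕ; inject₁; fromℕ; punchIn; _≟_)
open import Data.Fin.Properties using (toℕ<n; toℕ-injective; suc-injective; punchIn-injective; punchInᵢ≢i; any?; all?; ¬∀⟶∃¬)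
open import Data.Fin.Relation.Unary.Top using (view; ‵fromℕ; ‵inject₁)
open import Data.Fin.Subset using (Subset; ∣_∣) renaming (_∈_ to _∈ₛ_)
open import Data.Fin.Subset.Properties using (p⊆q⇒∣p∣≤∣q∣; p⊂q⇒∣p∣<∣q∣)
open import Data.Vec using (tabulate)
open import Data.Vec.Properties using (lookup∘tabulate; []=⇒lookup; lookup⇒[]=)
open import Data.List using (allFin)
open import Data.List.Relation.Unary.All as All using ()
open import Data.List.Membership.Propositional.Properties using (∈-allFin)
open import Data.List.Extrema.Nat using (argmax; f[xs]≤f[argmax])
open import Data.Bool using (Bool; true; false; _∨_)
open import Data.Bool.Properties using (∨-comm; not-¬; ¬-not) renaming (_≟_ to _≟ᵇ_)
open import Data.Product using (Σ; ∃; _×_; _,_; proj₁; proj₂; swap; map₂)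
open import Data.Sum using (_⊎_; inj₁; inj₂; [_,_])
open import Data.Empty using (⊥; ⊥-elim)
open import Data.Unit using (⊤; tt)
open import Function using (_∘_; id)
open import Function.Definitions using (Injective)
open import Relation.Nullary using (¬_; Dec; yes; no; does; ¬?)
open import Relation.Nullary.Decidable using (dec-true; toWitness; decidable-stable; _×-dec_; _⊎-dec_; _→-dec_)
open import Relation.Unary using (Pred; Decidable; _⊆_)
open import Relation.Binary.Definitions using (tri<; tri≈; tri>)
open import Relation.Binary.PropositionalEquality using (_≡_; _≢_; refl; sym; trans; cong; subst)

from-does : ∀ {p} {P : Set p} (P? : Dec P) → does P? ≡ true → P
from-does (yes p) _ = p

module _ {n : ℕ} {p q} {P : Pred (Fin n) p} {Q : Pred (Fin n) q}
         (P? : Decidable P) (Q? : Decidable Q) where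

  ⊆-or-counterexample : P ⊆ Q ⊎ ∃ λ x → P x × ¬ Q x
  ⊆-or-counterexample with any? (λ x → P? x ×-dec ¬? (Q? x))
  ... | yes counterexample = inj₂ counterexample
  ... | no none = inj₁ λ {x} px → decidable-stable (Q? x) (λ ¬qx → none (x , px , ¬qx))

subset : ∀ {n p} {P : Pred (Fin n) p} → Decidable P → Subset n
subset P? = tabulate (does ∘ P?)

module _ {n : ℕ} {p} {P : Pred (Fin n) p} (P? : Decidable P) where

  ∈-subset⁺ : ∀ {x} → P x → x ∈ₛ subset P?
  ∈-subset⁺ {x} px = lookup⇒[]= x _ (trans (lookup∘tabulate _ x) (dec-true (P? x) px))

  ∈-subset⁻ : ∀ {x} → x ∈ₛ subset P? → P x
  ∈-subset⁻ {x} x∈ = from-does (P? x) (trans (sym (lookup∘tabulate _ x)) ([]=⇒lookup x∈))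

module _ {n : ℕ} {p q} {P : Pred (Fin n) p} {Q : Pred (Fin n) q}
         (P? : Decidable P) (Q? : Decidable Q) where

  ∣subset∣-strictMono : P ⊆ Q → ∀ {x} → Q x → ¬ P x → ∣ subset P? ∣ < ∣ subset Q? ∣
  ∣subset∣-strictMono P⊆Q {x} qx ¬px =
    p⊂q⇒∣p∣<∣q∣ (∈-subset⁺ Q? ∘ P⊆Q ∘ ∈-subset⁻ P? , x , ∈-subset⁺ Q? qx , ¬px ∘ ∈-subset⁻ P?)

Minimiser : ∀ {n p} → Pred (Fin n) p → (Fin n → ℕ) → Set p
Minimiser {n} P f = Σ (Fin n) λ z → P z × (∀ z′ → P z′ → f z ≤ f z′)

minimiser? : ∀ {n p} {P : Pred (Fin n) p} → Decidable P → (f : Fin n → ℕ) →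
             Minimiser P f ⊎ (∀ z → ¬ P z)
minimiser? {zero} P? f = inj₂ λ ()
minimiser? {suc n} P? f with P? zero | minimiser? (P? ∘ suc) (f ∘ suc)
... | no ¬p₀ | inj₂ none = inj₂ λ { zero → ¬p₀ ; (suc z) → none z }
... | no ¬p₀ | inj₁ (z , pz , min) =
  inj₁ (suc z , pz , λ { zero p₀ → ⊥-elim (¬p₀ p₀) ; (suc z′) → min z′ })
... | yes p₀ | inj₂ none =
  inj₁ (zero , p₀ , λ { zero _ → ≤-refl ; (suc z′) p → ⊥-elim (none z′ p) })
... | yes p₀ | inj₁ (z , pz , min) with f zero ≤? f (suc z)
...   | yes f₀≤ = inj₁ (zero , p₀ , λ { zero _ → ≤-refl ; (suc z′) p → ≤-trans f₀≤ (min z′ p) })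
...   | no  f₀≰ = inj₁ (suc z , pz , λ { zero _ → <⇒≤ (≰⇒> f₀≰) ; (suc z′) → min z′ })

argmax-maximal : ∀ {n} (f : Fin (suc n) → ℕ) j → f j ≤ f (argmax f zero (allFin (suc n)))
argmax-maximal {n} f j = All.lookup (f[xs]≤f[argmax] {f = f} zero (allFin (suc n))) (∈-allFin j)

module _ (G : Graph) where

  Independent : Vtx G → Vtx G → Set
  Independent x y = x ≢ y × adj G x y ≡ false

  ClosedNbr : Vtx G → Vtx G → Set
  ClosedNbr x y = x ≡ y ⊎ adj G x y ≡ true

  ClosedNbr? : ∀ x y → Dec (ClosedNbr x y)
  ClosedNbr? x y = (x ≟ y) ⊎-dec (adj G x y ≟ᵇ true)

  closedDegree : Vtx G → ℕ
  closedDegree x = ∣ subset (ClosedNbr? x) ∣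

module GraphProperties (G : Graph) where

  adj-sym : ∀ {x y b} → adj G x y ≡ b → adj G y x ≡ b
  adj-sym {x} {y} = trans (Graph.sym G y x)

  adj-distinct : ∀ {x y} → adj G x y ≡ true → x ≢ y
  adj-distinct {x} xy refl = not-¬ (irrefl G x) xy

  Independent-sym : ∀ {x y} → Independent G x y → Independent G y x
  Independent-sym (x≢y , xy) = x≢y ∘ sym , adj-sym xy

  closedNbr⇒¬independent : ∀ {x y} → ClosedNbr G x y → ¬ Independent G x y
  closedNbr⇒¬independent (inj₁ x≡y) (x≢y , _) = x≢y x≡y
  closedNbr⇒¬independent (inj₂ xy) (_ , xy′) = not-¬ xy′ xy

  independent-images : ∀ {s} {f : Fin s → Vtx G} → Injective _≡_ _≡_ f →
                       (∀ i j → adj G (f i) (f j) ≡ false) → ∀ {i j} → i ≢ j → Independent G (f i) (f j)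
  independent-images f-inj indep i≢j = i≢j ∘ f-inj , indep _ _

  IndepAtMost-clique-∪ : ∀ (K : Vtx G → Set) {X Y : VSet G} {k} →
                         (∀ {x y} → K x → K y → ClosedNbr G x y) →
                         (∀ {x} → X x ≡ true → K x ⊎ Y x ≡ true) →
                         IndepAtMost G Y k → IndepAtMost G X (suc k)
  IndepAtMost-clique-∪ K clique split αY zero f _ _ _ = z≤n
  IndepAtMost-clique-∪ K {Y = Y} clique split αY (suc s) f f-inj inX indep
    with all? (λ i → Y (f i) ≟ᵇ true)
  ... | yes allInY = m≤n⇒m≤1+n (αY (suc s) f f-inj allInY indep)
  ... | no ¬allInY with ¬∀⟶∃¬ (suc s) _ (λ i → Y (f i) ≟ᵇ true) ¬allInY
  ...   | i , fi∉Y = s≤s (αY s (f ∘ punchIn i) (punchIn-injective i _ _ ∘ f-inj) othersInY (λ _ _ → indep _ _))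
    where
    fi∈K : K (f i)
    fi∈K = [ id , ⊥-elim ∘ fi∉Y ] (split (inX i))

    -- At most one vertex of an independent set lies in the clique K, namely f i.
    othersInY : ∀ j → Y (f (punchIn i j)) ≡ true
    othersInY j with split (inX (punchIn i j))
    ... | inj₂ inY = inY
    ... | inj₁ inK = ⊥-elim (closedNbr⇒¬independent (clique fi∈K inK)
                                (independent-images f-inj indep (punchInᵢ≢i i j ∘ sym)))

  separated-distinct : ∀ (H : Graph) {f : Vtx H → Vtx G} → (∀ i j → adj G (f i) (f j) ≡ adj H i j) →
                       ∀ {i j} l → adj H i l ≢ adj H j l → f i ≢ f j
  separated-distinct H {f} faithful {i} {j} l differ fi≡fj =
    differ (trans (sym (faithful i l)) (trans (cong (λ x → adj G x (f l)) fi≡fj) (faithful j l)))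

  Reach-snoc : ∀ {S u w x} → Reach G S u w → S x ≡ true → adj G w x ≡ true → Reach G S u x
  Reach-snoc (here su) sx wx = step su wx (here sx)
  Reach-snoc (step su uw r) sx wx = step su uw (Reach-snoc r sx wx)

  Reach-reverse : ∀ {S u w} → Reach G S u w → Reach G S w u
  Reach-reverse (here su) = here su
  Reach-reverse (step su uw r) = Reach-snoc (Reach-reverse r) su (adj-sym uw)

  Reach-++ : ∀ {S u w x} → Reach G S u w → Reach G S w x → Reach G S u x
  Reach-++ (here _) r = r
  Reach-++ (step su uw r) r′ = step su uw (Reach-++ r r′)

  cycle-neighbours : ∀ {k} (c : Fin (suc (suc (suc k))) → Vtx G) →
                     (∀ i → adj G (c (inject₁ i)) (c (suc i)) ≡ true) →
                     adj G (c (fromℕ (suc (suc k)))) (c zero) ≡ true →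
                     ∀ i → Σ _ λ j → Σ _ λ j′ → j ≢ j′ × adj G (c i) (c j) ≡ true × adj G (c i) (c j′) ≡ true
  cycle-neighbours c next close zero = suc zero , fromℕ _ , (λ ()) , next zero , adj-sym close
  cycle-neighbours c next close (suc i) with view i
  ... | ‵fromℕ = inject₁ (fromℕ _) , zero , (λ ()) , adj-sym (next (fromℕ _)) , close
  ... | ‵inject₁ j = inject₁ (inject₁ j) , suc (suc j) , inject₁²≢2+ j , adj-sym (next (inject₁ j)) , next (suc j)
    where
    inject₁²≢2+ : ∀ {m} (j : Fin m) → inject₁ (inject₁ j) ≢ suc (suc j)
    inject₁²≢2+ zero ()
    inject₁²≢2+ (suc j) eq = inject₁²≢2+ j (suc-injective eq)

-- Node zero is the root and node suc a hangs below parent a.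
module ParentTree {m : ℕ} (parent : Fin m → Fin (suc m)) (depth : Fin (suc m) → ℕ)
                  (depth-parent : ∀ a → depth (parent a) < depth (suc a)) where

  IsParent : Fin (suc m) → Fin (suc m) → Bool
  IsParent zero    _ = false
  IsParent (suc a) y = does (parent a ≟ y)

  IsParent-irrefl : ∀ x → IsParent x x ≡ false
  IsParent-irrefl zero = refl
  IsParent-irrefl (suc a) with parent a ≟ suc a
  ... | yes eq = ⊥-elim (<-irrefl (cong depth eq) (depth-parent a))
  ... | no _ = refl

  tree : Graph
  tree = record
    { n = suc m
    ; adj = λ x y → IsParent x y ∨ IsParent y x
    ; sym = λ x y → ∨-comm (IsParent x y) (IsParent y x)
    ; irrefl = λ x → cong (λ b → b ∨ b) (IsParent-irrefl x)
    }

  open GraphProperties tree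

  up : Fin (suc m) → Fin (suc m)
  up zero = zero
  up (suc a) = parent a

  child-parent-adjacent : ∀ a → adj tree (suc a) (parent a) ≡ true
  child-parent-adjacent a = cong (_∨ IsParent (parent a) (suc a)) (dec-true (parent a ≟ parent a) refl)

  adjacent-shallower-is-up : ∀ x y → adj tree x y ≡ true → depth y ≤ depth x → up x ≡ y
  adjacent-shallower-is-up x y xy y≤x with IsParent x y in x→y
  adjacent-shallower-is-up (suc a) y xy y≤x | true = from-does (parent a ≟ y) x→y
  adjacent-shallower-is-up x (suc b) xy y≤x | false =
    ⊥-elim (<⇒≱ (subst (λ z → depth z < depth (suc b)) (from-does (parent b ≟ x) xy) (depth-parent b)) y≤x)

  -- On a cycle, the deepest node would have two distinct neighbours that are both its parent.
  acyclic : ¬ HasCycle tree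
  acyclic (k , c , c-inj , next , close) =
    let j , j′ , j≢j′ , dj , dj′ = cycle-neighbours c next close deepest
    in j≢j′ (c-inj (trans (sym (neighbour-is-up dj)) (neighbour-is-up dj′)))
    where
    deepest : Fin (suc (suc (suc k)))
    deepest = argmax (depth ∘ c) zero (allFin _)

    neighbour-is-up : ∀ {j} → adj tree (c deepest) (c j) ≡ true → up (c deepest) ≡ c j
    neighbour-is-up {j} d = adjacent-shallower-is-up _ _ d (argmax-maximal (depth ∘ c) j)

  parent-closed-connected : (S : VSet tree) (top : Fin (suc m)) → S top ≡ true →
                            (S zero ≡ true → zero ≡ top) →
                            (∀ a → S (suc a) ≡ true → suc a ≢ top → S (parent a) ≡ true) →
                            ConnectedSet tree S
  parent-closed-connected S top top∈S root∈S⇒top closed x y x∈S y∈S =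
    Reach-++ (climb _ x ≤-refl x∈S) (Reach-reverse (climb _ y ≤-refl y∈S))
    where
    climb : ∀ fuel x → depth x < fuel → S x ≡ true → Reach tree S x top
    climb (suc fuel) x _ x∈S with x ≟ top
    ... | yes refl = here x∈S
    climb (suc fuel) zero _ x∈S | no x≢top = ⊥-elim (x≢top (root∈S⇒top x∈S))
    climb (suc fuel) (suc a) (s≤s d<fuel) a∈S | no a≢top =
      step a∈S (child-parent-adjacent a)
        (climb fuel (parent a) (<-≤-trans (depth-parent a) d<fuel) (closed a a∈S a≢top))

  isTree : IsTree tree
  isTree = record
    { nonempty = zero
    ; connected = parent-closed-connected (λ _ → true) zero refl (λ _ → refl) (λ _ _ _ → refl)
    ; acyclic = acyclic
    }

TreeAlphaAtMost-empty : ∀ (G : Graph) → (Vtx G → ⊥) → ∀ k → TreeAlphaAtMost G k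
TreeAlphaAtMost-empty G empty k = decomposition , λ _ → emptyBag
  where
  open ParentTree {0} (λ ()) (λ _ → 0) (λ ())

  decomposition : TreeDecomposition G
  decomposition = record
    { T = tree ; isTree = isTree ; bag = λ _ _ → false
    ; cover = ⊥-elim ∘ empty ; edge = λ x _ _ → ⊥-elim (empty x) ; interp = λ _ _ _ () }

  emptyBag : IndepAtMost G (λ _ → false) k
  emptyBag zero _ _ _ _ = z≤n
  emptyBag (suc s) f _ inX _ with inX zero
  ... | ()

P4+P1-twinFree : ∀ i j → i ≢ j → ∃ λ l → adj P4+P1 i l ≢ adj P4+P1 j l
P4+P1-twinFree = toWitness {a? = all? λ i → all? λ j → ¬? (i ≟ j) →-dec
                                   any? λ l → ¬? (adj P4+P1 i l ≟ᵇ adj P4+P1 j l)} tt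

module ForbiddenFree (G : Graph) (free : Free Forbidden G) where
  open GraphProperties G

  no-P4+P1 : ∀ {a b c d e} →
             adj G a b ≡ true → adj G b c ≡ true → adj G c d ≡ true →
             adj G a c ≡ false → adj G a d ≡ false → adj G b d ≡ false →
             adj G a e ≡ false → adj G b e ≡ false → adj G c e ≡ false → adj G d e ≡ false → ⊥
  no-P4+P1 {a} {b} {c} {d} {e} ab bc cd ac ad bd ae be ce de =
    free P4+P1 isP4+P1 (f , f-injective , faithful)
    where
    f : Fin 5 → Vtx G
    f zero = a
    f (suc zero) = b
    f (suc (suc zero)) = c
    f (suc (suc (suc zero))) = d
    f (suc (suc (suc (suc zero)))) = e

    faithful : ∀ i j → adj G (f i) (f j) ≡ adj P4+P1 i j
    faithful zero zero = irrefl G a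
    faithful zero (suc zero) = ab
    faithful zero (suc (suc zero)) = ac
    faithful zero (suc (suc (suc zero))) = ad
    faithful zero (suc (suc (suc (suc zero)))) = ae
    faithful (suc zero) zero = adj-sym ab
    faithful (suc zero) (suc zero) = irrefl G b
    faithful (suc zero) (suc (suc zero)) = bc
    faithful (suc zero) (suc (suc (suc zero))) = bd
    faithful (suc zero) (suc (suc (suc (suc zero)))) = be
    faithful (suc (suc zero)) zero = adj-sym ac
    faithful (suc (suc zero)) (suc zero) = adj-sym bc
    faithful (suc (suc zero)) (suc (suc zero)) = irrefl G c
    faithful (suc (suc zero)) (suc (suc (suc zero))) = cd
    faithful (suc (suc zero)) (suc (suc (suc (suc zero)))) = ce
    faithful (suc (suc (suc zero))) zero = adj-sym ad
    faithful (suc (suc (suc zero))) (suc zero) = adj-sym bd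
    faithful (suc (suc (suc zero))) (suc (suc zero)) = adj-sym cd
    faithful (suc (suc (suc zero))) (suc (suc (suc zero))) = irrefl G d
    faithful (suc (suc (suc zero))) (suc (suc (suc (suc zero)))) = de
    faithful (suc (suc (suc (suc zero)))) zero = adj-sym ae
    faithful (suc (suc (suc (suc zero)))) (suc zero) = adj-sym be
    faithful (suc (suc (suc (suc zero)))) (suc (suc zero)) = adj-sym ce
    faithful (suc (suc (suc (suc zero)))) (suc (suc (suc zero))) = adj-sym de
    faithful (suc (suc (suc (suc zero)))) (suc (suc (suc (suc zero)))) = irrefl G e

    f-injective : Injective _≡_ _≡_ f
    f-injective {i} {j} fi≡fj with i ≟ j
    ... | yes i≡j = i≡j
    ... | no i≢j with P4+P1-twinFree i j i≢j
    ...   | l , differ = ⊥-elim (separated-distinct P4+P1 faithful l differ fi≡fj)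

  -- Opposite vertices of C4 are twins, so their distinctness must be assumed.
  no-C4 : ∀ {a b c d} → a ≢ c → b ≢ d →
          adj G a b ≡ true → adj G b c ≡ true → adj G c d ≡ true → adj G d a ≡ true →
          adj G a c ≡ false → adj G b d ≡ false → ⊥
  no-C4 {a} {b} {c} {d} a≢c b≢d ab bc cd da ac bd =
    free C4 isC4 (g , g-injective _ _ , faithful)
    where
    g : Fin 4 → Vtx G
    g zero = a
    g (suc zero) = b
    g (suc (suc zero)) = c
    g (suc (suc (suc zero))) = d

    faithful : ∀ i j → adj G (g i) (g j) ≡ adj C4 i j
    faithful zero zero = irrefl G a
    faithful zero (suc zero) = ab
    faithful zero (suc (suc zero)) = ac
    faithful zero (suc (suc (suc zero))) = adj-sym da
    faithful (suc zero) zero = adj-sym ab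
    faithful (suc zero) (suc zero) = irrefl G b
    faithful (suc zero) (suc (suc zero)) = bc
    faithful (suc zero) (suc (suc (suc zero))) = bd
    faithful (suc (suc zero)) zero = adj-sym ac
    faithful (suc (suc zero)) (suc zero) = adj-sym bc
    faithful (suc (suc zero)) (suc (suc zero)) = irrefl G c
    faithful (suc (suc zero)) (suc (suc (suc zero))) = cd
    faithful (suc (suc (suc zero))) zero = da
    faithful (suc (suc (suc zero))) (suc zero) = adj-sym bd
    faithful (suc (suc (suc zero))) (suc (suc zero)) = adj-sym cd
    faithful (suc (suc (suc zero))) (suc (suc (suc zero))) = irrefl G d

    separated : ∀ {i j} l → adj C4 i l ≢ adj C4 j l → g i ≢ g j
    separated = separated-distinct C4 faithful

    g-injective : ∀ i j → g i ≡ g j → i ≡ j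
    g-injective zero zero _ = refl
    g-injective zero (suc zero) = ⊥-elim ∘ separated zero (λ ())
    g-injective zero (suc (suc zero)) = ⊥-elim ∘ a≢c
    g-injective zero (suc (suc (suc zero))) = ⊥-elim ∘ separated zero (λ ())
    g-injective (suc zero) zero = ⊥-elim ∘ separated zero (λ ())
    g-injective (suc zero) (suc zero) _ = refl
    g-injective (suc zero) (suc (suc zero)) = ⊥-elim ∘ separated zero (λ ())
    g-injective (suc zero) (suc (suc (suc zero))) = ⊥-elim ∘ b≢d
    g-injective (suc (suc zero)) zero = ⊥-elim ∘ a≢c ∘ sym
    g-injective (suc (suc zero)) (suc zero) = ⊥-elim ∘ separated zero (λ ())
    g-injective (suc (suc zero)) (suc (suc zero)) _ = refl
    g-injective (suc (suc zero)) (suc (suc (suc zero))) = ⊥-elim ∘ separated zero (λ ())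
    g-injective (suc (suc (suc zero))) zero = ⊥-elim ∘ separated zero (λ ())
    g-injective (suc (suc (suc zero))) (suc zero) = ⊥-elim ∘ b≢d ∘ sym
    g-injective (suc (suc (suc zero))) (suc (suc zero)) = ⊥-elim ∘ separated zero (λ ())
    g-injective (suc (suc (suc zero))) (suc (suc (suc zero))) _ = refl

  -- A path a-b-c-d closes into a C4 or, with e, induces P4+P1.
  path₄-dominating : ∀ {a b c d} → adj G a b ≡ true → adj G b c ≡ true → adj G c d ≡ true →
                     Independent G a c → Independent G b d →
                     ∀ e → adj G a e ≡ false → adj G b e ≡ false → adj G c e ≡ false → adj G d e ≡ false → ⊥
  path₄-dominating {a} {d = d} ab bc cd (a≢c , ac) (b≢d , bd) e ae be ce de with adj G a d in ad
  ... | true  = no-C4 a≢c b≢d ab bc cd (adj-sym ad) ac bd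
  ... | false = no-P4+P1 ab bc cd ac ad bd ae be ce de

module MinDegreeVertex (G : Graph) (free : Free Forbidden G) (v : Vtx G)
                       (v-min : ∀ x → closedDegree G v ≤ closedDegree G x) where
  open GraphProperties G
  open ForbiddenFree G free

  Far : Vtx G → Set
  Far x = v ≢ x × adj G v x ≡ false

  Far? : ∀ x → Dec (Far x)
  Far? x = ¬? (v ≟ x) ×-dec (adj G v x ≟ᵇ false)

  far-nonadjacent-v : ∀ {x} → Far x → adj G x v ≡ false
  far-nonadjacent-v = adj-sym ∘ proj₂

  far⇒¬closed : ∀ {x} → Far x → ¬ ClosedNbr G v x
  far⇒¬closed (v≢x , _) (inj₁ v≡x) = v≢x v≡x
  far⇒¬closed (_ , vx) (inj₂ vx′) = not-¬ vx vx′

  ¬closed⇒far : ∀ {x} → ¬ ClosedNbr G v x → Far x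
  ¬closed⇒far ¬vx = ¬vx ∘ inj₁ , ¬-not (¬vx ∘ inj₂)

  closed-or-far : ∀ x → ClosedNbr G v x ⊎ Far x
  closed-or-far x with ClosedNbr? G v x
  ... | yes vx = inj₁ vx
  ... | no ¬vx = inj₂ (¬closed⇒far ¬vx)

  nbr-far-distinct : ∀ {w x} → adj G v w ≡ true → Far x → w ≢ x
  nbr-far-distinct vw x-far refl = far⇒¬closed x-far (inj₂ vw)

  -- A common neighbour x ∉ N[v] of p and q would close the C4 p-x-q-v.
  no-common-far-nbr : ∀ {p q x} → adj G v p ≡ true → adj G v q ≡ true → Independent G p q →
                      Far x → adj G p x ≡ true → adj G q x ≡ false
  no-common-far-nbr vp vq (p≢q , pq) x-far px =
    ¬-not λ qx → no-C4 p≢q (proj₁ x-far ∘ sym) px (adj-sym qx) (adj-sym vq) vp pq (far-nonadjacent-v x-far)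

  -- Without a far neighbour, N[w] ⊆ N[v] ∖ {w′}, contradicting the minimality of the degree of v.
  has-far-nbr : ∀ {w w′} → adj G v w ≡ true → adj G v w′ ≡ true → Independent G w w′ →
                ∃ λ x → Far x × adj G w x ≡ true
  has-far-nbr {w} {w′} vw vw′ w≁w′ with ⊆-or-counterexample (ClosedNbr? G w) (ClosedNbr? G v)
  ... | inj₁ w⊆v = ⊥-elim (<⇒≱ (∣subset∣-strictMono (ClosedNbr? G w) (ClosedNbr? G v) w⊆v (inj₂ vw′)
                                   (λ ww′ → closedNbr⇒¬independent ww′ w≁w′)) (v-min w))
  ... | inj₂ (x , inj₁ refl , ¬vx) = ⊥-elim (¬vx (inj₂ vw))
  ... | inj₂ (x , inj₂ wx , ¬vx) = x , ¬closed⇒far ¬vx , wx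

  -- w₁ and w₃ have far neighbours x₁ and x₃ that no other vertex of the triple sees;
  -- then w₁-x₁-x₃-w₃ is a path missed by w₂ if x₁ ~ x₃, and x₁-w₁-v-w₂ one missed by x₃ if not.
  nbhd-no-independent-triple : ∀ {w₁ w₂ w₃} → adj G v w₁ ≡ true → adj G v w₂ ≡ true → adj G v w₃ ≡ true →
                               Independent G w₁ w₂ → Independent G w₁ w₃ → Independent G w₂ w₃ → ⊥
  nbhd-no-independent-triple vw₁ vw₂ vw₃ i₁₂ i₁₃ i₂₃
    with has-far-nbr vw₁ vw₂ i₁₂ | has-far-nbr vw₃ vw₂ (Independent-sym i₂₃)
  ... | x₁ , x₁-far , w₁x₁ | x₃ , x₃-far , w₃x₃ with adj G x₁ x₃ in x₁x₃
  ... | true = path₄-dominating w₁x₁ x₁x₃ (adj-sym w₃x₃)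
                 (nbr-far-distinct vw₁ x₃-far , no-common-far-nbr vw₃ vw₁ (Independent-sym i₁₃) x₃-far w₃x₃)
                 (nbr-far-distinct vw₃ x₁-far ∘ sym , adj-sym (no-common-far-nbr vw₁ vw₃ i₁₃ x₁-far w₁x₁))
                 _ (proj₂ i₁₂) (adj-sym (no-common-far-nbr vw₁ vw₂ i₁₂ x₁-far w₁x₁))
                 (adj-sym (no-common-far-nbr vw₃ vw₂ (Independent-sym i₂₃) x₃-far w₃x₃)) (adj-sym (proj₂ i₂₃))
  ... | false = path₄-dominating (adj-sym w₁x₁) (adj-sym vw₁) vw₂
                  (proj₁ x₁-far ∘ sym , far-nonadjacent-v x₁-far) i₁₂
                  _ x₁x₃ (no-common-far-nbr vw₃ vw₁ (Independent-sym i₁₃) x₃-far w₃x₃) (proj₂ x₃-far)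
                  (no-common-far-nbr vw₃ vw₂ (Independent-sym i₂₃) x₃-far w₃x₃)

  nbhd-IndepAtMost-2 : IndepAtMost G (adj G v) 2
  nbhd-IndepAtMost-2 zero _ _ _ _ = z≤n
  nbhd-IndepAtMost-2 (suc zero) _ _ _ _ = s≤s z≤n
  nbhd-IndepAtMost-2 (suc (suc zero)) _ _ _ _ = s≤s (s≤s z≤n)
  nbhd-IndepAtMost-2 (suc (suc (suc s))) f f-inj inN indep =
    ⊥-elim (nbhd-no-independent-triple (inN zero) (inN (suc zero)) (inN (suc (suc zero)))
              (pair λ ()) (pair λ ()) (pair λ ()))
    where
    pair : ∀ {i j} → i ≢ j → Independent G (f i) (f j)
    pair = independent-images f-inj indep

  FarNbr : Vtx G → Vtx G → Set
  FarNbr x y = Far y × ClosedNbr G x y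

  FarNbr? : ∀ x y → Dec (FarNbr x y)
  FarNbr? x y = Far? y ×-dec ClosedNbr? G x y

  farDegree : Vtx G → ℕ
  farDegree x = ∣ subset (FarNbr? x) ∣

  -- The lexicographic order on (farDegree x, toℕ x), encoded in ℕ.
  rank : Vtx G → ℕ
  rank x = farDegree x * n G + toℕ x

  farDegree-<⇒rank-< : ∀ {x y} → farDegree x < farDegree y → rank x < rank y
  farDegree-<⇒rank-< {x} {y} fx<fy = begin-strict
    farDegree x * n G + toℕ x  <⟨ +-monoʳ-< (farDegree x * n G) (toℕ<n x) ⟩
    farDegree x * n G + n G    ≡⟨ +-comm (farDegree x * n G) (n G) ⟩
    suc (farDegree x) * n G    ≤⟨ *-monoˡ-≤ (n G) fx<fy ⟩
    farDegree y * n G          ≤⟨ m≤m+n (farDegree y * n G) (toℕ y) ⟩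
    rank y                     ∎
    where open ≤-Reasoning

  rank-≤⇒farDegree-≤ : ∀ {x y} → rank x ≤ rank y → farDegree x ≤ farDegree y
  rank-≤⇒farDegree-≤ {x} {y} rx≤ry with farDegree x ≤? farDegree y
  ... | yes fx≤fy = fx≤fy
  ... | no fx≰fy = ⊥-elim (<⇒≱ (farDegree-<⇒rank-< (≰⇒> fx≰fy)) rx≤ry)

  rank-injective : ∀ {x y} → rank x ≡ rank y → x ≡ y
  rank-injective {x} {y} rx≡ry = toℕ-injective (+-cancelˡ-≡ (farDegree x * n G) _ _
    (trans rx≡ry (cong (λ d → d * n G + toℕ y) (sym fx≡fy))))
    where
    fx≡fy : farDegree x ≡ farDegree y
    fx≡fy = ≤-antisym (rank-≤⇒farDegree-≤ (≤-reflexive rx≡ry)) (rank-≤⇒farDegree-≤ (≤-reflexive (sym rx≡ry)))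

  Up : Vtx G → Vtx G → Set
  Up a z = Far z × adj G a z ≡ true × rank a < rank z

  Up? : ∀ a z → Dec (Up a z)
  Up? a z = Far? z ×-dec ((adj G a z ≟ᵇ true) ×-dec (rank a <? rank z))

  farNbr-∖ : ∀ {u y b} → Far u → adj G u y ≡ true → FarNbr u b → ¬ FarNbr y b →
            adj G u b ≡ true × Independent G y b
  farNbr-∖ u-far uy (_ , inj₁ refl) ¬yb = ⊥-elim (¬yb (u-far , inj₂ (adj-sym uy)))
  farNbr-∖ u-far uy (b-far , inj₂ ub) ¬yb = ub , (¬yb ∘ (b-far ,_) ∘ inj₁) , ¬-not (¬yb ∘ (b-far ,_) ∘ inj₂)

  -- If not, pick b ∈ N[u] ∖ N[y] in M; since farDegree u ≤ farDegree y there is also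
  -- a ∈ N[y] ∖ N[u] in M, and then b-u-y-a is a path of four vertices missed by v.
  farNbr-⊆-Up : ∀ {u y} → Far u → Up u y → FarNbr u ⊆ FarNbr y
  farNbr-⊆-Up {u} {y} u-far (y-far , uy , u<y) with ⊆-or-counterexample (FarNbr? u) (FarNbr? y)
  ... | inj₁ u⊆y = u⊆y
  ... | inj₂ (b , ub , ¬yb) with ⊆-or-counterexample (FarNbr? y) (FarNbr? u)
  ...   | inj₁ y⊆u = ⊥-elim (<⇒≱ (∣subset∣-strictMono (FarNbr? y) (FarNbr? u) y⊆u ub ¬yb)
                                  (rank-≤⇒farDegree-≤ (<⇒≤ u<y)))
  ...   | inj₂ (a , ya , ¬ua) with farNbr-∖ u-far uy ub ¬yb | farNbr-∖ y-far (adj-sym uy) ya ¬ua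
  ...     | u~b , y≁b | y~a , u≁a =
    ⊥-elim (path₄-dominating (adj-sym u~b) uy y~a (Independent-sym y≁b) u≁a v
      (far-nonadjacent-v (proj₁ ub)) (far-nonadjacent-v u-far) (far-nonadjacent-v y-far) (far-nonadjacent-v (proj₁ ya)))

  Ceiling : Vtx G → Vtx G → Set
  Ceiling a z = a ≡ z ⊎ Up a z

  ceiling-farNbr : ∀ {a z} → Far a → Ceiling a z → FarNbr a z
  ceiling-farNbr a-far (inj₁ refl) = a-far , inj₁ refl
  ceiling-farNbr a-far (inj₂ (z-far , az , _)) = z-far , inj₂ az

  ceiling-clique : ∀ {a z z′} → Far a → Ceiling a z → Ceiling a z′ → ClosedNbr G z z′
  ceiling-clique a-far (inj₁ refl) c′ = proj₂ (ceiling-farNbr a-far c′)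
  ceiling-clique a-far (inj₂ up) c′ = proj₂ (farNbr-⊆-Up a-far up (ceiling-farNbr a-far c′))

  Down : Vtx G → Vtx G → Set
  Down a x = a ≡ x ⊎ (Far x × adj G x a ≡ true × rank x < rank a)

  Down? : ∀ a x → Dec (Down a x)
  Down? a x = (a ≟ x) ⊎-dec (Far? x ×-dec ((adj G x a ≟ᵇ true) ×-dec (rank x <? rank a)))

  Down-⊆-Up : ∀ {a p} → Far a → Up a p → Down a ⊆ Down p
  Down-⊆-Up a-far (_ , ap , a<p) (inj₁ refl) = inj₂ (a-far , ap , a<p)
  Down-⊆-Up a-far up@(_ , _ , a<p) (inj₂ (x-far , xa , x<a))
    with proj₂ (farNbr-⊆-Up a-far up (x-far , inj₂ (adj-sym xa)))
  ... | inj₁ refl = ⊥-elim (<-asym x<a a<p)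
  ... | inj₂ px = inj₂ (x-far , adj-sym px , <-trans x<a a<p)

  Side : Vtx G → Vtx G → Set
  Side a z = adj G v z ≡ true × ∃ λ x → Down a x × adj G z x ≡ true

  Side? : ∀ a z → Dec (Side a z)
  Side? a z = (adj G v z ≟ᵇ true) ×-dec any? (λ x → Down? a x ×-dec (adj G z x ≟ᵇ true))

  Side-⊆-Up : ∀ {a p} → Far a → Up a p → Side a ⊆ Side p
  Side-⊆-Up a-far up (vz , x , down , zx) = vz , x , Down-⊆-Up a-far up down , zx

  InBag : Vtx G → Vtx G → Set
  InBag a z = Far a × (Ceiling a z ⊎ Side a z)

  InBag? : ∀ a z → Dec (InBag a z)
  InBag? a z = Far? a ×-dec (((a ≟ z) ⊎-dec Up? a z) ⊎-dec Side? a z)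

  Node : Set
  Node = Fin (suc (n G))

  bag : Node → VSet G
  bag zero z = does (ClosedNbr? G v z)
  bag (suc a) z = does (InBag? a z)

  parentOf : ∀ {a} → Minimiser (Up a) rank ⊎ (∀ z → ¬ Up a z) → Node
  parentOf (inj₁ (p , _)) = suc p
  parentOf (inj₂ _) = zero

  parent : Vtx G → Node
  parent a = parentOf (minimiser? (Up? a) rank)

  depth : Node → ℕ
  depth zero = 0
  depth (suc a) = suc ∣ subset (λ z → rank a <? rank z) ∣

  depth-parent : ∀ a → depth (parent a) < depth (suc a)
  depth-parent a = go (minimiser? (Up? a) rank)
    where
    go : (r : Minimiser (Up a) rank ⊎ (∀ z → ¬ Up a z)) → depth (parentOf r) < depth (suc a)
    go (inj₂ _) = s≤s z≤n
    go (inj₁ (p , (_ , _ , a<p) , _)) =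
      s≤s (∣subset∣-strictMono (λ z → rank p <? rank z) (λ z → rank a <? rank z) (<-trans a<p) a<p (<-irrefl refl))

  open ParentTree parent depth depth-parent

  in-root : ∀ {z} → ClosedNbr G v z → bag zero z ≡ true
  in-root {z} = dec-true (ClosedNbr? G v z)

  in-own-bag : ∀ {z} → Far z → bag (suc z) z ≡ true
  in-own-bag {z} z-far = dec-true (InBag? z z) (z-far , inj₁ (inj₁ refl))

  cover : ∀ z → Σ Node λ t → bag t z ≡ true
  cover z with closed-or-far z
  ... | inj₁ vz = zero , in-root vz
  ... | inj₂ z-far = suc z , in-own-bag z-far

  up-edge : ∀ {x y} → Far x → Up x y → Σ Node λ t → bag t x ≡ true × bag t y ≡ true
  up-edge {x} {y} x-far up = suc x , in-own-bag x-far , dec-true (InBag? x y) (x-far , inj₁ (inj₂ up))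

  near-far-edge : ∀ {x y} → ClosedNbr G v x → Far y → adj G x y ≡ true →
                  Σ Node λ t → bag t x ≡ true × bag t y ≡ true
  near-far-edge (inj₁ refl) (_ , vy) vy′ = ⊥-elim (not-¬ vy vy′)
  near-far-edge {x} {y} (inj₂ vx) y-far xy =
    suc y , dec-true (InBag? y x) (y-far , inj₂ (vx , y , inj₁ refl , xy)) , in-own-bag y-far

  edge : ∀ x y → adj G x y ≡ true → Σ Node λ t → bag t x ≡ true × bag t y ≡ true
  edge x y xy with closed-or-far x | closed-or-far y
  ... | inj₁ vx | inj₁ vy = zero , in-root vx , in-root vy
  ... | inj₁ vx | inj₂ y-far = near-far-edge vx y-far xy
  ... | inj₂ x-far | inj₁ vy = map₂ swap (near-far-edge vy x-far (adj-sym xy))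
  ... | inj₂ x-far | inj₂ y-far with <-cmp (rank x) (rank y)
  ...   | tri< x<y _ _ = up-edge x-far (y-far , xy , x<y)
  ...   | tri≈ _ rx≡ry _ = ⊥-elim (adj-distinct xy (rank-injective rx≡ry))
  ...   | tri> _ _ y<x = map₂ swap (up-edge y-far (x-far , adj-sym xy , y<x))

  near-climbs : ∀ {z} → ClosedNbr G v z → ∀ a → bag (suc a) z ≡ true → bag (parent a) z ≡ true
  near-climbs {z} vz a z∈a with from-does (InBag? a z) z∈a
  ... | a-far , inj₁ ceiling = ⊥-elim (far⇒¬closed (proj₁ (ceiling-farNbr a-far ceiling)) vz)
  ... | a-far , inj₂ side = go (minimiser? (Up? a) rank)
    where
    go : (r : Minimiser (Up a) rank ⊎ (∀ z → ¬ Up a z)) → bag (parentOf r) z ≡ true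
    go (inj₂ _) = in-root (inj₂ (proj₁ side))
    go (inj₁ (p , up , _)) = dec-true (InBag? p z) (proj₁ up , inj₂ (Side-⊆-Up a-far up side))

  far-climbs : ∀ {z} → Far z → ∀ a → bag (suc a) z ≡ true → suc a ≢ suc z → bag (parent a) z ≡ true
  far-climbs {z} z-far a z∈a a≢z with from-does (InBag? a z) z∈a
  ... | _ , inj₂ (vz , _) = ⊥-elim (far⇒¬closed z-far (inj₂ vz))
  ... | _ , inj₁ (inj₁ refl) = ⊥-elim (a≢z refl)
  ... | a-far , inj₁ (inj₂ z-up) = go (minimiser? (Up? a) rank)
    where
    -- The minimal up-neighbour p of a is z itself or lies below z, adjacent to it.
    go : (r : Minimiser (Up a) rank ⊎ (∀ z → ¬ Up a z)) → bag (parentOf r) z ≡ true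
    go (inj₂ none) = ⊥-elim (none z z-up)
    go (inj₁ (p , p-up , p-min)) with ceiling-clique a-far (inj₂ p-up) (inj₂ z-up)
    ... | inj₁ p≡z = dec-true (InBag? p z) (proj₁ p-up , inj₁ (inj₁ p≡z))
    ... | inj₂ pz = dec-true (InBag? p z) (proj₁ p-up , inj₁ (inj₂ (z-far , pz , p<z)))
      where
      p<z : rank p < rank z
      p<z = ≤∧≢⇒< (p-min z z-up) (adj-distinct pz ∘ rank-injective)

  interp : ∀ z → ConnectedSet tree (λ t → bag t z)
  interp z with closed-or-far z
  ... | inj₁ vz = parent-closed-connected _ zero (in-root vz) (λ _ → refl) (λ a z∈a _ → near-climbs vz a z∈a)
  ... | inj₂ z-far = parent-closed-connected _ (suc z) (in-own-bag z-far)
                       (λ z∈root → ⊥-elim (far⇒¬closed z-far (from-does (ClosedNbr? G v z) z∈root)))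
                       (far-climbs z-far)

  decomposition : TreeDecomposition G
  decomposition = record
    { T = tree ; isTree = isTree ; bag = bag ; cover = cover ; edge = edge ; interp = interp }

  bag-IndepAtMost-3 : ∀ t → IndepAtMost G (bag t) 3
  bag-IndepAtMost-3 zero =
    IndepAtMost-clique-∪ (v ≡_) (λ { refl refl → inj₁ refl }) (from-does (ClosedNbr? G v _)) nbhd-IndepAtMost-2
  bag-IndepAtMost-3 (suc a) =
    IndepAtMost-clique-∪ (λ z → Far a × Ceiling a z) (λ (a-far , c) (_ , c′) → ceiling-clique a-far c c′)
      split nbhd-IndepAtMost-2
    where
    split : ∀ {z} → bag (suc a) z ≡ true → (Far a × Ceiling a z) ⊎ adj G v z ≡ true
    split {z} z∈a with from-does (InBag? a z) z∈a
    ... | a-far , inj₁ ceiling = inj₁ (a-far , ceiling)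
    ... | _ , inj₂ (vz , _) = inj₂ vz

  treeAlpha≤3 : TreeAlphaAtMost G 3
  treeAlpha≤3 = decomposition , bag-IndepAtMost-3

lemma6p5 : (G : Graph) → Free Forbidden G → TreeAlphaAtMost G 3
lemma6p5 G free with minimiser? {P = λ _ → ⊤} (λ _ → yes tt) (closedDegree G)
... | inj₁ (v , _ , v-min) = MinDegreeVertex.treeAlpha≤3 G free v (λ x → v-min x tt)
... | inj₂ noVertex = TreeAlphaAtMost-empty G (λ x → noVertex x tt) 3
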